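{- For every skew indecomposable involution $\beta$, we have $$\limsup_{n\to\infty}\sqrt[n]{|\operatorname{Av}^I_n(\beta)|}\ \ge\ \sqrt{\mathrm{gr}(\operatorname{Av}(\beta))},$$ where $\mathrm{gr}(\operatorname{Av}(\beta))=\lim_{n\to\infty}\sqrt[n]{|\operatorname{Av}_n(\beta)|}$.
   Context: A permutation $\pi$ contains $\sigma$ if $\pi$ has a subsequence order isomorphic to $\sigma$; otherwise it avoids $\sigma$. $\operatorname{Av}_n(\beta)$ is the set of permutations of length $n$ avoiding $\beta$, and $\operatorname{Av}^I_n(\beta)$ is the set of involutions of length $n$ avoiding $\beta$. (The limit defining $\mathrm{gr}(\operatorname{Av}(\beta))$ is known to exist for every single pattern $\beta$.) The skew sum $\sigma\ominus\tau$ of $\sigma$ of length $m$ and $\tau$ of length $n$ is the permutation with $(\sigma\ominus\tau)(i)=\sigma(i)+n$ for $i\le m$ and $(\sigma\ominus\tau)(i)=\tau(i-m)$ for $m<i\le m+n$; a permutation is skew indecomposable if it is not a skew sum of two nonempty permutations. -}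

module Defs where

open import Data.Nat using (ℕ; zero; suc; _+_; _*_; _^_; _≤_; _<_; _≡ᵇ_; _<ᵇ_)
open import Data.Bool using (Bool; true; false; _∧_; not; if_then_else_)
open import Data.List using (List; []; _∷_; length; map; upTo; filterᵇ; concatMap; _++_)
open import Data.Bool.ListAction using (all; any)
open import Data.List.Membership.Propositional using (_∈_)
open import Data.Product using (Σ; _×_; ∃; ∃-syntax)
open import Relation.Binary.PropositionalEquality using (_≡_)
open import Relation.Nullary using (¬_)

-- A permutation of length n is represented as the list of its values
-- [π(1)-1, …, π(n)-1], i.e. one-line notation with values in {0,…,n-1}.

-- i-th entry (0-based); default 0 out of range (never used in range checks).
at : List ℕ → ℕ → ℕ
at []       _       = 0
at (x ∷ xs) zero    = x
at (x ∷ xs) (suc i) = at xs i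

IsPerm : List ℕ → Set
IsPerm p = ∀ i → i < length p → i ∈ p

IsInvolution : List ℕ → Set
IsInvolution p = IsPerm p × (∀ i → i < length p → at p (at p i) ≡ i)

_⊖_ : List ℕ → List ℕ → List ℕ
σ ⊖ τ = map (λ x → x + length τ) σ ++ τ

SkewIndecomposable : List ℕ → Set
SkewIndecomposable β =
  ¬ (Σ (List ℕ) λ σ → Σ (List ℕ) λ τ →
       IsPerm σ × IsPerm τ × 0 < length σ × 0 < length τ × β ≡ (σ ⊖ τ))

elemᵇ : ℕ → List ℕ → Bool
elemᵇ x = any (λ y → x ≡ᵇ y)

isPermᵇ : List ℕ → Bool
isPermᵇ p = all (λ i → elemᵇ i p) (upTo (length p))

isInvolutionᵇ : List ℕ → Bool
isInvolutionᵇ p = isPermᵇ p ∧ all (λ i → at p (at p i) ≡ᵇ i) (upTo (length p))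

subseqs : ℕ → List ℕ → List (List ℕ)
subseqs zero    _        = [] ∷ []
subseqs (suc k) []       = []
subseqs (suc k) (x ∷ xs) = map (x ∷_) (subseqs k xs) ++ subseqs (suc k) xs

_==ᵇ_ : Bool → Bool → Bool
true  ==ᵇ b = b
false ==ᵇ b = not b

-- s is order isomorphic to σ (same length assumed)
orderIsoᵇ : List ℕ → List ℕ → Bool
orderIsoᵇ σ s =
  all (λ i → all (λ j → (at s i <ᵇ at s j) ==ᵇ (at σ i <ᵇ at σ j))
                 (upTo (length σ)))
      (upTo (length σ))

containsᵇ : List ℕ → List ℕ → Bool
containsᵇ π σ = any (orderIsoᵇ σ) (subseqs (length σ) π)

words : ℕ → ℕ → List (List ℕ)
words n zero    = [] ∷ []
words n (suc k) = concatMap (λ x → map (x ∷_) (words n k)) (upTo n)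

perms : ℕ → List (List ℕ)
perms n = filterᵇ isPermᵇ (words n n)

avCount : List ℕ → ℕ → ℕ
avCount β n = length (filterᵇ (λ π → not (containsᵇ π β)) (perms n))

avInvCount : List ℕ → ℕ → ℕ
avInvCount β n =
  length (filterᵇ (λ π → isInvolutionᵇ π ∧ not (containsᵇ π β)) (perms n))

-- Growth-rate comparison without real numbers.
-- For a nonnegative rational r = p/q (q ≥ 1):
--   "r² < gr(b)"  is encoded as: there is a rational s = u/v (v ≥ 1) with
--      s > r²  (i.e. p²·v < u·q²) and b n ≥ s^n for all large n
--      (i.e. u^n ≤ b n · v^n);
--   "infinitely often a n ≥ r^n" is: ∀ N ∃ n ≥ N, p^n ≤ a n · q^n.
-- limsup a_n^{1/n} ≥ √(gr) holds iff for every such r with r² < gr,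
-- a_n ≥ r^n infinitely often (given that gr is a limit).

GrowthAbove : (ℕ → ℕ) → ℕ → ℕ → Set
GrowthAbove b p q =
  Σ ℕ λ u → Σ ℕ λ v → 1 ≤ v × p * p * v < u * (q * q) ×
    (Σ ℕ λ N → ∀ n → N ≤ n → u ^ n ≤ b n * v ^ n)

InfOftenAbove : (ℕ → ℕ) → ℕ → ℕ → Set
InfOftenAbove a p q = ∀ N → Σ ℕ λ n → N ≤ n × p ^ n ≤ a n * q ^ n

-- If π avoids β, then π ⊖ π⁻¹ is an involution of twice the length, and it still avoids β:
-- an occurrence of the skew indecomposable β cannot straddle the two blocks, and an occurrence
-- inside the block π⁻¹ is an occurrence of β⁻¹ = β in π. As π ↦ π ⊖ π⁻¹ is injective,
-- |Av_n(β)| ≤ |Av^I_{2n}(β)|, so along even lengths the involutions grow at least like √gr.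

module Submission where

open import Defs
open import Data.Bool using (Bool; true; false; T; not; _∧_)
open import Data.Bool.ListAction using (all)
open import Data.Bool.Properties using (T-∧)
open import Data.Empty using (⊥-elim)
open import Data.List using (List; []; _∷_; _++_; length; map; concatMap; filterᵇ; upTo; applyUpTo; take; drop)
open import Data.List.Membership.Propositional using (_∈_; find; lose)
open import Data.List.Membership.Propositional.Properties
  using (∈-++⁺ˡ; ∈-++⁺ʳ; ∈-++⁻; ∈-∃++; ∈-map⁺; ∈-map⁻; ∈-applyUpTo⁺; ∈-applyUpTo⁻; ∈-upTo⁺; ∈-upTo⁻;
         ∈-concatMap⁺; ∈-concatMap⁻; ∈-filter⁺; ∈-filter⁻)
open import Data.List.Properties
  using (length-++; length-map; length-applyUpTo; length-upTo; length-take; length-drop;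
         take++drop≡id; map-∘; map-id-local; ∷-injectiveˡ; ∷-injectiveʳ)
open import Data.List.Relation.Binary.Subset.Propositional using (_⊆_)
open import Data.List.Relation.Unary.All using ([]; lookup; tabulate)
open import Data.List.Relation.Unary.All.Properties using (all⁺; all⁻; applyUpTo⁺₁; applyUpTo⁻)
open import Data.List.Relation.Unary.Any as Any using (here; there)
open import Data.List.Relation.Unary.Any.Properties using (any⁺; any⁻)
open import Data.List.Relation.Unary.Unique.Propositional using (Unique; []; _∷_)
open import Data.List.Relation.Unary.Unique.Propositional.Properties
  using (upTo⁺; map⁺; ++⁺; filter⁺) renaming (applyUpTo⁺₁ to Unique-applyUpTo⁺)
open import Data.Nat using (ℕ; zero; suc; _+_; _*_; _^_; _∸_; _≤_; _<_; _<ᵇ_; z≤n; s≤s)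
open import Data.Nat.Properties
open import Algebra.Properties.CommutativeSemigroup *-commutativeSemigroup using (interchange; xy∙z≈xz∙y)
open import Data.List.Membership.DecPropositional _≟_ using (_∈?_)
open import Data.Product using (Σ-syntax; ∃-syntax; _×_; _,_; proj₁; proj₂)
open import Data.Sum using (_⊎_; inj₁; inj₂)
open import Function using (id; _∘_; _⇔_; mk⇔; Equivalence)
open import Function.Properties.Equivalence using () renaming (trans to ⇔-trans; sym to ⇔-sym)
open import Relation.Binary.Definitions using (tri<; tri≈; tri>)
open import Relation.Binary.PropositionalEquality
  using (_≡_; _≢_; refl; sym; trans; cong; cong₂; subst; subst₂; module ≡-Reasoning)
open import Relation.Nullary using (¬_; yes; no)
open import Relation.Nullary.Decidable using (T?)

open Equivalence using (to; from)

T-not : ∀ {b} → ¬ T b → T (not b)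
T-not {false} _  = _
T-not {true}  ¬t = ¬t _

T-not⁻ : ∀ {b} → T (not b) → ¬ T b
T-not⁻ {false} _ ()

T-<ᵇ : ∀ {m n} → T (m <ᵇ n) ⇔ m < n
T-<ᵇ {m} {n} = mk⇔ (<ᵇ⇒< m n) <⇒<ᵇ

T-==ᵇ : ∀ {a b} → T (a ==ᵇ b) ⇔ (T a ⇔ T b)
T-==ᵇ {true}  {true}  = mk⇔ (λ _ → mk⇔ id id) (λ _ → _)
T-==ᵇ {true}  {false} = mk⇔ (λ ()) (λ h → to h _)
T-==ᵇ {false} {true}  = mk⇔ (λ ()) (λ h → from h _)
T-==ᵇ {false} {false} = mk⇔ (λ _ → mk⇔ id id) (λ _ → _)

T-all-upTo : ∀ (p : ℕ → Bool) n → T (all p (upTo n)) ⇔ (∀ {i} → i < n → T (p i))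
T-all-upTo p n = mk⇔ (applyUpTo⁻ id n ∘ all⁺ p (upTo n)) (all⁻ p ∘ applyUpTo⁺₁ id n)

T-elemᵇ : ∀ {x} xs → T (elemᵇ x xs) ⇔ x ∈ xs
T-elemᵇ {x} xs = mk⇔ (Any.map (≡ᵇ⇒≡ x _) ∘ any⁻ _ xs) (any⁺ _ ∘ Any.map λ { refl → ≡⇒≡ᵇ x x refl })

T-isPermᵇ : ∀ π → T (isPermᵇ π) ⇔ IsPerm π
T-isPermᵇ π = mk⇔
  (λ h i i<n → to (T-elemᵇ π) (to (T-all-upTo _ (length π)) h i<n))
  (λ h → from (T-all-upTo _ (length π)) λ {i} i<n → from (T-elemᵇ π) (h i i<n))

IsInvolution⇒isInvolutionᵇ : ∀ {π} → IsInvolution π → T (isInvolutionᵇ π)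
IsInvolution⇒isInvolutionᵇ {π} (perm , invol) = from T-∧
  (from (T-isPermᵇ π) perm , from (T-all-upTo _ (length π)) λ {i} i<n → ≡⇒≡ᵇ _ _ (invol i i<n))

Unique-⊆⇒length≤ : ∀ {A : Set} {xs ys : List A} → Unique xs → xs ⊆ ys → length xs ≤ length ys
Unique-⊆⇒length≤ [] _ = z≤n
Unique-⊆⇒length≤ {xs = x ∷ xs} (x∉xs ∷ xs!) x∷xs⊆ys with as , bs , refl ← ∈-∃++ (x∷xs⊆ys (here refl)) =
  subst (suc (length xs) ≤_) (sym length-removed) (s≤s (Unique-⊆⇒length≤ xs! xs⊆as++bs))
  where
  length-removed : length (as ++ x ∷ bs) ≡ suc (length (as ++ bs))
  length-removed = trans (length-++ as) (trans (+-suc (length as) (length bs)) (cong suc (sym (length-++ as))))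
  xs⊆as++bs : xs ⊆ as ++ bs
  xs⊆as++bs {y} y∈xs with ∈-++⁻ as (x∷xs⊆ys (there y∈xs))
  ... | inj₁ y∈as          = ∈-++⁺ˡ y∈as
  ... | inj₂ (here refl)   = ⊥-elim (lookup x∉xs y∈xs refl)
  ... | inj₂ (there y∈bs)  = ∈-++⁺ʳ as y∈bs

Unique-⊆-length≤⇒⊇ : ∀ {xs ys : List ℕ} → Unique xs → xs ⊆ ys → length ys ≤ length xs → ys ⊆ xs
Unique-⊆-length≤⇒⊇ {xs} {ys} xs! xs⊆ys |ys|≤|xs| {y} y∈ys with y ∈? xs
... | yes y∈xs = y∈xs
... | no  y∉xs = ⊥-elim (<-irrefl refl (≤-trans (Unique-⊆⇒length≤ y∷xs! y∷xs⊆ys) |ys|≤|xs|))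
  where
  y∷xs! : Unique (y ∷ xs)
  y∷xs! = tabulate (λ { z∈xs refl → y∉xs z∈xs }) ∷ xs!
  y∷xs⊆ys : y ∷ xs ⊆ ys
  y∷xs⊆ys (here refl) = y∈ys
  y∷xs⊆ys (there z∈xs) = xs⊆ys z∈xs

injective-into-range⇒≤ : ∀ (f : ℕ → ℕ) m {a b} →
  (∀ {i j} → i < m → j < m → f i ≡ f j → i ≡ j) → (∀ {i} → i < m → a ≤ f i × f i < b) → m ≤ b ∸ a
injective-into-range⇒≤ f m {a} {b} f-inj f-range =
  subst₂ _≤_ (length-applyUpTo f m) (length-applyUpTo (a +_) (b ∸ a))
    (Unique-⊆⇒length≤ (Unique-applyUpTo⁺ f m λ i<j j<m e → <-irrefl (f-inj (<-trans i<j j<m) j<m e) i<j)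
                      image⊆range)
  where
  image⊆range : applyUpTo f m ⊆ applyUpTo (a +_) (b ∸ a)
  image⊆range v∈ with i , i<m , refl ← ∈-applyUpTo⁻ f v∈ =
    let a≤fi , fi<b = f-range i<m
    in subst (_∈ _) (m+[n∸m]≡n a≤fi) (∈-applyUpTo⁺ (a +_) (∸-monoˡ-< fi<b a≤fi))

at-∈ : ∀ xs {i} → i < length xs → at xs i ∈ xs
at-∈ (x ∷ xs) {zero}  _         = here refl
at-∈ (x ∷ xs) {suc i} (s≤s i<n) = there (at-∈ xs i<n)

∈⇒at : ∀ {x} xs → x ∈ xs → ∃[ i ] i < length xs × at xs i ≡ x
∈⇒at (y ∷ xs) (here refl) = 0 , s≤s z≤n , refl
∈⇒at (y ∷ xs) (there x∈xs) with i , i<n , refl ← ∈⇒at xs x∈xs = suc i , s≤s i<n , refl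

at-∷ : ∀ x xs {i} → 0 < i → at (x ∷ xs) i ≡ at xs (i ∸ 1)
at-∷ x xs (s≤s _) = refl

at-map : ∀ (f : ℕ → ℕ) xs {i} → i < length xs → at (map f xs) i ≡ f (at xs i)
at-map f (x ∷ xs) {zero}  _         = refl
at-map f (x ∷ xs) {suc i} (s≤s i<n) = at-map f xs i<n

at-++ˡ : ∀ xs ys {i} → i < length xs → at (xs ++ ys) i ≡ at xs i
at-++ˡ (x ∷ xs) ys {zero}  _         = refl
at-++ˡ (x ∷ xs) ys {suc i} (s≤s i<n) = at-++ˡ xs ys i<n

at-++ʳ : ∀ xs ys {i} → length xs ≤ i → at (xs ++ ys) i ≡ at ys (i ∸ length xs)
at-++ʳ []       ys _         = refl
at-++ʳ (x ∷ xs) ys (s≤s n≤i) = at-++ʳ xs ys n≤i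

at-take : ∀ xs {t i} → i < t → at (take t xs) i ≡ at xs i
at-take []       {suc t} _                 = refl
at-take (x ∷ xs) {suc t} {zero}  _         = refl
at-take (x ∷ xs) {suc t} {suc i} (s≤s i<t) = at-take xs i<t

at-drop : ∀ xs t i → at (drop t xs) i ≡ at xs (t + i)
at-drop xs       zero    i = refl
at-drop []       (suc t) i = refl
at-drop (x ∷ xs) (suc t) i = at-drop xs t i

at-applyUpTo : ∀ (f : ℕ → ℕ) n {i} → i < n → at (applyUpTo f n) i ≡ f i
at-applyUpTo f (suc n) {zero}  _         = refl
at-applyUpTo f (suc n) {suc i} (s≤s i<n) = at-applyUpTo (f ∘ suc) n i<n

length-⊖ : ∀ σ τ → length (σ ⊖ τ) ≡ length σ + length τ
length-⊖ σ τ = trans (length-++ (map _ σ)) (cong (_+ length τ) (length-map _ σ))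

at-⊖ˡ : ∀ σ τ {i} → i < length σ → at (σ ⊖ τ) i ≡ at σ i + length τ
at-⊖ˡ σ τ i<m = trans (at-++ˡ (map _ σ) τ (subst (_ <_) (sym (length-map _ σ)) i<m)) (at-map _ σ i<m)

at-⊖ʳ : ∀ σ τ {i} → length σ ≤ i → at (σ ⊖ τ) i ≡ at τ (i ∸ length σ)
at-⊖ʳ σ τ {i} m≤i = trans (at-++ʳ (map _ σ) τ (subst (_≤ i) (sym (length-map _ σ)) m≤i))
                          (cong (λ m → at τ (i ∸ m)) (length-map _ σ))

IsPerm⇒bounded : ∀ {π x} → IsPerm π → x ∈ π → x < length π
IsPerm⇒bounded {π} perm = ∈-upTo⁻ ∘ Unique-⊆-length≤⇒⊇ (upTo⁺ n) upTo⊆π (≤-reflexive (sym (length-upTo n)))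
  where
  n = length π
  upTo⊆π : upTo n ⊆ π
  upTo⊆π i∈ = perm _ (∈-upTo⁻ i∈)

at-bounded : ∀ {π i} → IsPerm π → i < length π → at π i < length π
at-bounded {π} perm i<n = IsPerm⇒bounded perm (at-∈ π i<n)

position : ℕ → List ℕ → ℕ
position x []       = 0
position x (y ∷ ys) with x ≟ y
... | yes _ = 0
... | no  _ = suc (position x ys)

position-at : ∀ {x} xs → x ∈ xs → position x xs < length xs × at xs (position x xs) ≡ x
position-at {x} (y ∷ ys) x∈ with x ≟ y | x∈
... | yes refl | _           = s≤s z≤n , refl
... | no  x≢y  | here x≡y    = ⊥-elim (x≢y x≡y)
... | no  _    | there x∈ys  = let i<n , at≡x = position-at ys x∈ys in s≤s i<n , at≡x

inverse : List ℕ → List ℕ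
inverse π = applyUpTo (λ j → position j π) (length π)

record Inverses (π ρ : List ℕ) : Set where
  field
    length-≡ : length ρ ≡ length π
    inverseˡ : ∀ {i} → i < length π → at ρ (at π i) ≡ i
    inverseʳ : ∀ {j} → j < length π → at π (at ρ j) ≡ j

module _ {π : List ℕ} (perm : IsPerm π) where
  private
    n = length π

    position-π : ∀ {j} → j < n → position j π < n × at π (position j π) ≡ j
    position-π j<n = position-at π (perm _ j<n)

  -- π ∘ position = id makes the n positions distinct, so they exhaust [0, n) by counting.
  upTo⊆inverse : upTo n ⊆ inverse π
  upTo⊆inverse = Unique-⊆-length≤⇒⊇ (Unique-applyUpTo⁺ _ n distinct) inverse⊆upTo
                   (≤-reflexive (trans (length-upTo n) (sym (length-applyUpTo _ n))))
    where
    distinct : ∀ {i j} → i < j → j < n → position i π ≢ position j π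
    distinct {i} {j} i<j j<n e = <⇒≢ i<j (begin
      i                   ≡⟨ proj₂ (position-π (<-trans i<j j<n)) ⟨
      at π (position i π) ≡⟨ cong (at π) e ⟩
      at π (position j π) ≡⟨ proj₂ (position-π j<n) ⟩
      j                   ∎)
      where open ≡-Reasoning
    inverse⊆upTo : inverse π ⊆ upTo n
    inverse⊆upTo v∈ with j , j<n , refl ← ∈-applyUpTo⁻ _ v∈ = ∈-upTo⁺ (proj₁ (position-π j<n))

  IsPerm-inverse : IsPerm (inverse π)
  IsPerm-inverse i i<n = upTo⊆inverse (∈-upTo⁺ (subst (i <_) (length-applyUpTo _ n) i<n))

  inverse-Inverses : Inverses π (inverse π)
  inverse-Inverses = record
    { length-≡ = length-applyUpTo _ n
    ; inverseˡ = λ i<n → left-inverse (∈-applyUpTo⁻ _ (upTo⊆inverse (∈-upTo⁺ i<n)))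
    ; inverseʳ = λ j<n → trans (cong (at π) (at-applyUpTo _ n j<n)) (proj₂ (position-π j<n))
    }
    where
    left-inverse : ∀ {i} → ∃[ j ] j < n × i ≡ position j π → at (inverse π) (at π i) ≡ i
    left-inverse (j , j<n , refl) = trans (cong (at (inverse π)) (proj₂ (position-π j<n))) (at-applyUpTo _ n j<n)

at-injective : ∀ {π a b} → IsPerm π → a < length π → b < length π → at π a ≡ at π b → a ≡ b
at-injective {π} perm a<n b<n e = trans (sym (inverseˡ a<n)) (trans (cong (at (inverse π)) e) (inverseˡ b<n))
  where open Inverses (inverse-Inverses perm)

IsPerm-⊖ : ∀ {σ τ} → IsPerm σ → IsPerm τ → IsPerm (σ ⊖ τ)
IsPerm-⊖ {σ} {τ} σ-perm τ-perm x x<len with x <? length τ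
... | yes x<|τ| = ∈-++⁺ʳ _ (τ-perm x x<|τ|)
... | no  x≮|τ| = ∈-++⁺ˡ (subst (_∈ map (_+ length τ) σ) (m∸n+n≡m |τ|≤x)
                    (∈-map⁺ (_+ length τ) (σ-perm (x ∸ length τ) x-|τ|<|σ|)))
  where
  |τ|≤x = ≮⇒≥ x≮|τ|
  x-|τ|<|σ| : x ∸ length τ < length σ
  x-|τ|<|σ| = subst (x ∸ length τ <_) (m+n∸n≡m (length σ) (length τ))
                (∸-monoˡ-< (subst (x <_) (length-⊖ σ τ) x<len) |τ|≤x)

⊖-involution : ∀ {π ρ} → IsPerm π → IsPerm ρ → Inverses π ρ → IsInvolution (π ⊖ ρ)
⊖-involution {π} {ρ} π-perm ρ-perm inv = IsPerm-⊖ π-perm ρ-perm , involutive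
  where
  open Inverses inv
  open ≡-Reasoning
  n = length π
  F = π ⊖ ρ
  involutive : ∀ i → i < length F → at F (at F i) ≡ i
  involutive i i<2n with i <? n
  ... | yes i<n = begin
    at F (at F i)                ≡⟨ cong (at F) (at-⊖ˡ π ρ i<n) ⟩
    at F (at π i + length ρ)     ≡⟨ at-⊖ʳ π ρ n≤ ⟩
    at ρ (at π i + length ρ ∸ n) ≡⟨ cong (λ m → at ρ (at π i + m ∸ n)) length-≡ ⟩
    at ρ (at π i + n ∸ n)        ≡⟨ cong (at ρ) (m+n∸n≡m (at π i) n) ⟩
    at ρ (at π i)                ≡⟨ inverseˡ i<n ⟩
    i                            ∎
    where
    n≤ : n ≤ at π i + length ρ
    n≤ = subst (λ m → n ≤ at π i + m) (sym length-≡) (m≤n+m n (at π i))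
  ... | no i≮n = begin
    at F (at F i)            ≡⟨ cong (at F) (at-⊖ʳ π ρ n≤i) ⟩
    at F (at ρ j)            ≡⟨ at-⊖ˡ π ρ ρj<n ⟩
    at π (at ρ j) + length ρ ≡⟨ cong₂ _+_ (inverseʳ j<n) length-≡ ⟩
    j + n                    ≡⟨ m∸n+n≡m n≤i ⟩
    i                        ∎
    where
    n≤i = ≮⇒≥ i≮n
    j = i ∸ n
    j<n : j < n
    j<n = subst (j <_) (m+n∸n≡m n n)
            (∸-monoˡ-< (subst (i <_) (trans (length-⊖ π ρ) (cong (n +_) length-≡)) i<2n) n≤i)
    ρj<n : at ρ j < n
    ρj<n = subst (at ρ j <_) length-≡ (at-bounded ρ-perm (subst (j <_) (sym length-≡) j<n))

record Embedding (k n : ℕ) : Set where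
  field
    pos       : ℕ → ℕ
    pos-<     : ∀ {i j} → i < j → j < k → pos i < pos j
    pos-bound : ∀ {i} → i < k → pos i < n

  pos-≤ : ∀ {i j} → i ≤ j → j < k → pos i ≤ pos j
  pos-≤ i≤j j<k with m≤n⇒m<n∨m≡n i≤j
  ... | inj₁ i<j  = <⇒≤ (pos-< i<j j<k)
  ... | inj₂ refl = ≤-refl

  pos-<⇔ : ∀ {i j} → i < k → j < k → pos i < pos j ⇔ i < j
  pos-<⇔ {i} {j} i<k j<k = mk⇔ reflect (λ i<j → pos-< i<j j<k)
    where
    reflect : pos i < pos j → i < j
    reflect pi<pj with <-cmp i j
    ... | tri< i<j _ _    = i<j
    ... | tri≈ _ refl _   = ⊥-elim (<-irrefl refl pi<pj)
    ... | tri> _ _ j<i    = ⊥-elim (<-asym pi<pj (pos-< j<i i<k))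

open Embedding

embedding-[] : ∀ {n} → Embedding 0 n
embedding-[] .pos       = id
embedding-[] .pos-< _ ()
embedding-[] .pos-bound ()

embedding-∷ : ∀ {k n} → Embedding k n → Embedding (suc k) (suc n)
embedding-∷ e .pos zero    = zero
embedding-∷ e .pos (suc i) = suc (pos e i)
embedding-∷ e .pos-< {zero}  {suc j} _         _         = s≤s z≤n
embedding-∷ e .pos-< {suc i} {suc j} (s≤s i<j) (s≤s j<k) = s≤s (pos-< e i<j j<k)
embedding-∷ e .pos-bound {zero}  _         = s≤s z≤n
embedding-∷ e .pos-bound {suc i} (s≤s i<k) = s≤s (pos-bound e i<k)

embedding-skip : ∀ {k n} → Embedding k n → Embedding k (suc n)
embedding-skip e .pos i         = suc (pos e i)
embedding-skip e .pos-< i<j j<k = s≤s (pos-< e i<j j<k)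
embedding-skip e .pos-bound i<k = s≤s (pos-bound e i<k)

embedding-tail : ∀ {k n} → Embedding (suc k) n → Embedding k n
embedding-tail e .pos i         = pos e (suc i)
embedding-tail e .pos-< i<j j<k = pos-< e (s≤s i<j) (s≤s j<k)
embedding-tail e .pos-bound i<k = pos-bound e (s≤s i<k)

embedding-unskip : ∀ {k n} (e : Embedding k (suc n)) → (∀ {i} → i < k → 0 < pos e i) → Embedding k n
embedding-unskip e positive .pos i         = pos e i ∸ 1
embedding-unskip e positive .pos-< i<j j<k = ∸-monoˡ-< (pos-< e i<j j<k) (positive (<-trans i<j j<k))
embedding-unskip e positive .pos-bound i<k = ∸-monoˡ-< (pos-bound e i<k) (positive i<k)

∈-subseqs⁻ : ∀ k xs {s} → s ∈ subseqs k xs →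
  Σ[ e ∈ Embedding k (length xs) ] (∀ {i} → i < k → at s i ≡ at xs (pos e i))
∈-subseqs⁻ zero    xs       (here refl) = embedding-[] , λ ()
∈-subseqs⁻ (suc k) (x ∷ xs) s∈ with ∈-++⁻ (map (x ∷_) (subseqs k xs)) s∈
... | inj₁ s∈kept with s , s∈′ , refl ← ∈-map⁻ (x ∷_) s∈kept =
  let e , at-s = ∈-subseqs⁻ k xs s∈′
  in embedding-∷ e , λ { {zero} _ → refl ; {suc i} (s≤s i<k) → at-s i<k }
... | inj₂ s∈skipped =
  let e , at-s = ∈-subseqs⁻ (suc k) xs s∈skipped
  in embedding-skip e , at-s

∈-subseqs⁺ : ∀ k xs (e : Embedding k (length xs)) →
  ∃[ s ] s ∈ subseqs k xs × (∀ {i} → i < k → at s i ≡ at xs (pos e i))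
∈-subseqs⁺ zero    xs       e = [] , here refl , λ ()
∈-subseqs⁺ (suc k) []       e = ⊥-elim (n≮0 (pos-bound e (s≤s z≤n)))
∈-subseqs⁺ (suc k) (x ∷ xs) e with pos e 0 in e₀≡
... | zero =
  let s , s∈ , at-s = ∈-subseqs⁺ k xs (embedding-unskip (embedding-tail e) positive)
  in x ∷ s , ∈-++⁺ˡ (∈-map⁺ (x ∷_) s∈) ,
     λ { {zero} _ → sym (cong (at (x ∷ xs)) e₀≡)
       ; {suc i} (s≤s i<k) → trans (at-s i<k) (sym (at-∷ x xs (positive i<k))) }
  where
  positive : ∀ {i} → i < k → 0 < pos e (suc i)
  positive i<k = subst (_< pos e (suc _)) e₀≡ (pos-< e (s≤s z≤n) (s≤s i<k))
... | suc _ =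
  let s , s∈ , at-s = ∈-subseqs⁺ (suc k) xs (embedding-unskip e positive)
  in s , ∈-++⁺ʳ _ s∈ , λ i<k → trans (at-s i<k) (sym (at-∷ x xs (positive i<k)))
  where
  positive : ∀ {i} → i < suc k → 0 < pos e i
  positive i<k = <-≤-trans (subst (0 <_) (sym e₀≡) (s≤s z≤n)) (pos-≤ e z≤n i<k)

record Occurrence (σ π : List ℕ) : Set where
  field
    embedding : Embedding (length σ) (length π)
    order     : ∀ {i j} → i < length σ → j < length σ →
                at π (pos embedding i) < at π (pos embedding j) ⇔ at σ i < at σ j

T-<ᵇ-==ᵇ : ∀ a b c d → T ((a <ᵇ b) ==ᵇ (c <ᵇ d)) ⇔ (a < b ⇔ c < d)
T-<ᵇ-==ᵇ a b c d = mk⇔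
  (λ h → ⇔-trans (⇔-sym (T-<ᵇ {a} {b})) (⇔-trans (to T-==ᵇ h) (T-<ᵇ {c} {d})))
  (λ h → from T-==ᵇ (⇔-trans (T-<ᵇ {a} {b}) (⇔-trans h (⇔-sym (T-<ᵇ {c} {d})))))

T-orderIsoᵇ : ∀ σ s → T (orderIsoᵇ σ s) ⇔
  (∀ {i j} → i < length σ → j < length σ → at s i < at s j ⇔ at σ i < at σ j)
T-orderIsoᵇ σ s = mk⇔
  (λ h {i} {j} i<k j<k → to (T-<ᵇ-==ᵇ _ _ _ _) (to (T-all-upTo _ k) (to (T-all-upTo _ k) h i<k) j<k))
  (λ h → from (T-all-upTo _ k) λ {i} i<k → from (T-all-upTo _ k) λ {j} j<k → from (T-<ᵇ-==ᵇ _ _ _ _) (h i<k j<k))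
  where k = length σ

T-containsᵇ : ∀ π σ → T (containsᵇ π σ) ⇔ Occurrence σ π
T-containsᵇ π σ = mk⇔ occurrence contains
  where
  k = length σ
  occurrence : T (containsᵇ π σ) → Occurrence σ π
  occurrence h =
    let s , s∈ , iso = find (any⁻ _ _ h)
        e , at-s     = ∈-subseqs⁻ k π s∈
    in record
      { embedding = e
      ; order = λ i<k j<k → subst₂ (λ a b → a < b ⇔ _) (at-s i<k) (at-s j<k) (to (T-orderIsoᵇ σ s) iso i<k j<k)
      }
  contains : Occurrence σ π → T (containsᵇ π σ)
  contains occ =
    let open Occurrence occ
        s , s∈ , at-s = ∈-subseqs⁺ k π embedding
    in any⁺ _ (lose s∈ (from (T-orderIsoᵇ σ s) λ i<k j<k →
         subst₂ (λ a b → a < b ⇔ _) (sym (at-s i<k)) (sym (at-s j<k)) (order i<k j<k)))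

pos-threshold : ∀ {k n} (e : Embedding k n) m →
  ∃[ t ] t ≤ k × (∀ {i} → i < t → pos e i < m) × (∀ {j} → t ≤ j → j < k → m ≤ pos e j)
pos-threshold {zero}  e m = 0 , z≤n , (λ ()) , λ _ ()
pos-threshold {suc k} e m with pos e 0 <? m
... | no e₀≮m = 0 , z≤n , (λ ()) , λ _ j<k → ≤-trans (≮⇒≥ e₀≮m) (pos-≤ e z≤n j<k)
... | yes e₀<m with t , t≤k , below , above ← pos-threshold (embedding-tail e) m =
  suc t , s≤s t≤k , below′ , above′
  where
  below′ : ∀ {i} → i < suc t → pos e i < m
  below′ {zero}  _         = e₀<m
  below′ {suc i} (s≤s i<t) = below i<t
  above′ : ∀ {j} → suc t ≤ j → j < suc k → m ≤ pos e j
  above′ {suc j} (s≤s t≤j) (s≤s j<k) = above t≤j j<k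

SkewCut : List ℕ → ℕ → Set
SkewCut β t = ∀ {i j} → i < t → t ≤ j → j < length β → at β j < at β i

module _ {β σ τ : List ℕ} (occ : Occurrence β (σ ⊖ τ)) where
  open Occurrence occ
  private
    k = length β
    p = pos embedding

    τ-index< : ∀ {j} → j < k → length σ ≤ p j → p j ∸ length σ < length τ
    τ-index< j<k |σ|≤pj = subst (_ <_) (m+n∸m≡n (length σ) (length τ))
                        (∸-monoˡ-< (subst (_ <_) (length-⊖ σ τ) (pos-bound embedding j<k)) |σ|≤pj)

  Occurrence-⊖ˡ : (∀ {i} → i < k → p i < length σ) → Occurrence β σ
  Occurrence-⊖ˡ in-σ = record
    { embedding = record { pos = p ; pos-< = pos-< embedding ; pos-bound = in-σ }
    ; order     = λ i<k j<k → ⇔-trans (shift i<k j<k) (order i<k j<k)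
    }
    where
    shift : ∀ {i j} → i < k → j < k → at σ (p i) < at σ (p j) ⇔ at (σ ⊖ τ) (p i) < at (σ ⊖ τ) (p j)
    shift {i} {j} i<k j<k =
      subst₂ (λ a b → at σ (p i) < at σ (p j) ⇔ a < b) (sym (at-⊖ˡ σ τ (in-σ i<k))) (sym (at-⊖ˡ σ τ (in-σ j<k)))
        (mk⇔ (+-monoˡ-< (length τ)) (+-cancelʳ-< (length τ) _ _))

  Occurrence-⊖ʳ : (∀ {j} → j < k → length σ ≤ p j) → Occurrence β τ
  Occurrence-⊖ʳ in-τ = record
    { embedding = record
      { pos       = λ i → p i ∸ length σ
      ; pos-<     = λ i<j j<k → ∸-monoˡ-< (pos-< embedding i<j j<k) (in-τ (<-trans i<j j<k))
      ; pos-bound = λ i<k → τ-index< i<k (in-τ i<k)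
      }
    ; order     = λ i<k j<k →
        subst₂ (λ a b → a < b ⇔ _) (at-⊖ʳ σ τ (in-τ i<k)) (at-⊖ʳ σ τ (in-τ j<k)) (order i<k j<k)
    }

  -- Values of σ ⊖ τ taken from τ are below length τ, those taken from σ are above it.
  Occurrence-⊖-cut : IsPerm τ → ∀ {t} → (∀ {i} → i < t → p i < length σ) →
                     (∀ {j} → t ≤ j → j < k → length σ ≤ p j) → t ≤ k → SkewCut β t
  Occurrence-⊖-cut τ-perm below above t≤k {i} {j} i<t t≤j j<k = to (order j<k i<k) (begin-strict
    at (σ ⊖ τ) (p j)            ≡⟨ at-⊖ʳ σ τ (above t≤j j<k) ⟩
    at τ (p j ∸ length σ)       <⟨ at-bounded τ-perm (τ-index< j<k (above t≤j j<k)) ⟩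
    length τ                    ≤⟨ m≤n+m (length τ) (at σ (p i)) ⟩
    at σ (p i) + length τ       ≡⟨ at-⊖ˡ σ τ (below i<t) ⟨
    at (σ ⊖ τ) (p i)            ∎)
    where
    open ≤-Reasoning
    i<k = <-≤-trans i<t t≤k

module _ {β : List ℕ} {t : ℕ} (perm : IsPerm β) (t<k : t < length β) (cut : SkewCut β t) where
  private
    k = length β
    c = k ∸ t

    t+c≡k : t + c ≡ k
    t+c≡k = m+[n∸m]≡n (<⇒≤ t<k)

  -- The t entries before the cut are distinct and lie in (at β j, k).
  skewCut-after< : ∀ {j} → t ≤ j → j < k → at β j < c
  skewCut-after< {j} t≤j j<k = m+n≤o⇒m≤o∸n (suc (at β j)) (begin
    suc (at β j) + t                  ≤⟨ +-monoʳ-≤ (suc (at β j)) t≤ ⟩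
    suc (at β j) + (k ∸ suc (at β j)) ≡⟨ m+[n∸m]≡n (at-bounded perm j<k) ⟩
    k                                 ∎)
    where
    open ≤-Reasoning
    t≤ : t ≤ k ∸ suc (at β j)
    t≤ = injective-into-range⇒≤ (at β) t
           (λ i<t i′<t → at-injective perm (<-trans i<t t<k) (<-trans i′<t t<k))
           (λ i<t → cut i<t t≤j j<k , at-bounded perm (<-trans i<t t<k))

  -- The c entries after the cut are distinct and lie below at β i.
  skewCut-before≥ : ∀ {i} → i < t → c ≤ at β i
  skewCut-before≥ i<t = injective-into-range⇒≤ (λ z → at β (t + z)) c
    (λ z<c z′<c e → +-cancelˡ-≡ t _ _ (at-injective perm (t+z<k z<c) (t+z<k z′<c) e))
    (λ {z} z<c → z≤n , cut i<t (m≤m+n t z) (t+z<k z<c))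
    where
    t+z<k : ∀ {z} → z < c → t + z < k
    t+z<k z<c = subst (_ <_) t+c≡k (+-monoʳ-< t z<c)

  private
    |take|≡t : length (take t β) ≡ t
    |take|≡t = trans (length-take t β) (m≤n⇒m⊓n≡m (<⇒≤ t<k))

    |drop|≡c : length (drop t β) ≡ c
    |drop|≡c = length-drop t β

    c≤taken : ∀ {v} → v ∈ take t β → c ≤ v
    c≤taken v∈ with p , p<|take| , refl ← ∈⇒at (take t β) v∈ =
      let p<t = subst (p <_) |take|≡t p<|take| in subst (c ≤_) (sym (at-take β p<t)) (skewCut-before≥ p<t)

    large⇒taken : ∀ {v} → v ∈ β → c ≤ v → v ∈ take t β
    large⇒taken v∈β c≤v with ∈⇒at β v∈β
    ... | p , p<k , refl with t ≤? p
    ... | yes t≤p = ⊥-elim (<⇒≱ (skewCut-after< t≤p p<k) c≤v)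
    ... | no  t≰p = let p<t = ≰⇒> t≰p in
      subst (_∈ take t β) (at-take β p<t) (at-∈ (take t β) (subst (p <_) (sym |take|≡t) p<t))

    small⇒dropped : ∀ {v} → v ∈ β → v < c → v ∈ drop t β
    small⇒dropped v∈β v<c with ∈⇒at β v∈β
    ... | p , p<k , refl with t ≤? p
    ... | no  t≰p = ⊥-elim (<⇒≱ v<c (skewCut-before≥ (≰⇒> t≰p)))
    ... | yes t≤p = subst (_∈ drop t β) (trans (at-drop β t (p ∸ t)) (cong (at β) (m+[n∸m]≡n t≤p)))
                      (at-∈ (drop t β) (subst (p ∸ t <_) (sym |drop|≡c) (∸-monoˡ-< p<k t≤p)))

  skewCut-upper : List ℕ
  skewCut-upper = map (_∸ c) (take t β)

  IsPerm-skewCut-upper : IsPerm skewCut-upper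
  IsPerm-skewCut-upper i i<|σ| =
    subst (_∈ skewCut-upper) (m+n∸n≡m i c) (∈-map⁺ (_∸ c) (large⇒taken (perm (i + c) i+c<k) (m≤n+m c i)))
    where
    i+c<k : i + c < k
    i+c<k = subst (i + c <_) t+c≡k (+-monoˡ-< c (subst (i <_) (trans (length-map _ (take t β)) |take|≡t) i<|σ|))

  IsPerm-skewCut-lower : IsPerm (drop t β)
  IsPerm-skewCut-lower i i<c = small⇒dropped (perm i (<-≤-trans i<c′ (m∸n≤m k t))) i<c′
    where
    i<c′ = subst (i <_) |drop|≡c i<c

  skewCut-⊖ : β ≡ skewCut-upper ⊖ drop t β
  skewCut-⊖ = begin
    β                                            ≡⟨ take++drop≡id t β ⟨
    take t β ++ drop t β                         ≡⟨ cong (_++ drop t β) (map-id-local (tabulate (m∸n+n≡m ∘ c≤taken))) ⟨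
    map (λ v → v ∸ c + c) (take t β) ++ drop t β ≡⟨ cong (_++ drop t β) (map-∘ (take t β)) ⟩
    map (_+ c) skewCut-upper ++ drop t β         ≡⟨ cong (λ m → map (_+ m) skewCut-upper ++ drop t β) |drop|≡c ⟨
    skewCut-upper ⊖ drop t β                     ∎
    where open ≡-Reasoning

  skewCut⇒¬SkewIndecomposable : 0 < t → ¬ SkewIndecomposable β
  skewCut⇒¬SkewIndecomposable 0<t indecomposable = indecomposable
    ( skewCut-upper , drop t β , IsPerm-skewCut-upper , IsPerm-skewCut-lower
    , subst (0 <_) (sym (trans (length-map _ (take t β)) |take|≡t)) 0<t
    , subst (0 <_) (sym |drop|≡c) (m<n⇒0<n∸m t<k)
    , skewCut-⊖ )

Occurrence-⊖ : ∀ {β σ τ} → IsPerm β → SkewIndecomposable β → IsPerm τ →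
               Occurrence β (σ ⊖ τ) → Occurrence β σ ⊎ Occurrence β τ
Occurrence-⊖ {β} {σ} β-perm indecomposable τ-perm occ
  with pos-threshold (Occurrence.embedding occ) (length σ)
... | zero  , _   , _     , above = inj₂ (Occurrence-⊖ʳ occ (above z≤n))
... | suc t , t≤k , below , above with m≤n⇒m<n∨m≡n t≤k
...   | inj₂ t≡k  = inj₁ (Occurrence-⊖ˡ occ (below ∘ subst (_ <_) (sym t≡k)))
...   | inj₁ t<k  = ⊥-elim (skewCut⇒¬SkewIndecomposable β-perm t<k
                      (Occurrence-⊖-cut occ τ-perm below above t≤k) (s≤s z≤n) indecomposable)

involution-Inverses : ∀ {β} → IsInvolution β → Inverses β β
involution-Inverses (_ , involutive) = record
  { length-≡ = refl ; inverseˡ = involutive _ ; inverseʳ = involutive _ }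

Occurrence-inverse : ∀ {σ σ′ π ρ} → IsPerm σ′ → IsPerm ρ → Inverses σ σ′ → Inverses π ρ →
                     Occurrence σ ρ → Occurrence σ′ π
Occurrence-inverse {σ} {σ′} {π} {ρ} σ′-perm ρ-perm σσ′ πρ occ = record
  { embedding = record { pos = pos′ ; pos-< = pos′-< ; pos-bound = pos′-bound }
  ; order     = order′
  }
  where
  open Occurrence occ
  module σσ′ = Inverses σσ′
  module πρ = Inverses πρ
  e = embedding

  σ′-bound : ∀ {t} → t < length σ′ → at σ′ t < length σ
  σ′-bound t<k = subst (_ <_) σσ′.length-≡ (at-bounded σ′-perm t<k)

  pos-σ′<|π| : ∀ {t} → t < length σ′ → pos e (at σ′ t) < length π
  pos-σ′<|π| t<k = subst (_ <_) πρ.length-≡ (pos-bound e (σ′-bound t<k))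

  pos′ : ℕ → ℕ
  pos′ t = at ρ (pos e (at σ′ t))

  pos′-< : ∀ {t u} → t < u → u < length σ′ → pos′ t < pos′ u
  pos′-< {t} {u} t<u u<k = from (order (σ′-bound t<k) (σ′-bound u<k))
    (subst₂ _<_ (sym (σσ′.inverseʳ (to-σ t<k))) (sym (σσ′.inverseʳ (to-σ u<k))) t<u)
    where
    t<k = <-trans t<u u<k
    to-σ : ∀ {v} → v < length σ′ → v < length σ
    to-σ = subst (_ <_) σσ′.length-≡

  pos′-bound : ∀ {t} → t < length σ′ → pos′ t < length π
  pos′-bound t<k = subst (_ <_) πρ.length-≡ (at-bounded ρ-perm (pos-bound e (σ′-bound t<k)))

  order′ : ∀ {t u} → t < length σ′ → u < length σ′ → at π (pos′ t) < at π (pos′ u) ⇔ at σ′ t < at σ′ u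
  order′ t<k u<k =
    subst₂ (λ a b → a < b ⇔ _) (sym (πρ.inverseʳ (pos-σ′<|π| t<k))) (sym (πρ.inverseʳ (pos-σ′<|π| u<k)))
      (pos-<⇔ e (σ′-bound t<k) (σ′-bound u<k))

⊖-inverse-avoids : ∀ {β π} → IsInvolution β → SkewIndecomposable β → IsPerm π →
                   ¬ Occurrence β π → ¬ Occurrence β (π ⊖ inverse π)
⊖-inverse-avoids β-involution@(β-perm , _) indecomposable π-perm avoids occ
  with Occurrence-⊖ β-perm indecomposable (IsPerm-inverse π-perm) occ
... | inj₁ in-π   = avoids in-π
... | inj₂ in-π⁻¹ = avoids (Occurrence-inverse β-perm (IsPerm-inverse π-perm)
                             (involution-Inverses β-involution) (inverse-Inverses π-perm) in-π⁻¹)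

∈-words⁻ : ∀ n k {w} → w ∈ words n k → length w ≡ k
∈-words⁻ n zero    (here refl) = refl
∈-words⁻ n (suc k) w∈ with x , _ , w∈x∷ ← find (∈-concatMap⁻ (λ x → map (x ∷_) (words n k)) {xs = upTo n} w∈)
                      with w , w∈′ , refl ← ∈-map⁻ (x ∷_) w∈x∷ = cong suc (∈-words⁻ n k w∈′)

∈-words⁺ : ∀ n k {w} → length w ≡ k → (∀ {x} → x ∈ w → x < n) → w ∈ words n k
∈-words⁺ n zero    {[]}    _   _     = here refl
∈-words⁺ n (suc k) {x ∷ w} |w| bound =
  ∈-concatMap⁺ (λ y → map (y ∷_) (words n k)) {xs = upTo n}
    (lose (∈-upTo⁺ (bound (here refl))) (∈-map⁺ (x ∷_) (∈-words⁺ n k (suc-injective |w|) (bound ∘ there))))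

Unique-words : ∀ n k → Unique (words n k)
Unique-words n zero    = [] ∷ []
Unique-words n (suc k) = extensions (upTo⁺ n)
  where
  W = words n k
  extensions : ∀ {xs} → Unique xs → Unique (concatMap (λ x → map (x ∷_) W) xs)
  extensions []                       = []
  extensions {x ∷ xs} (x∉xs ∷ xs!) = ++⁺ (map⁺ ∷-injectiveʳ (Unique-words n k)) (extensions xs!) disjoint
    where
    disjoint : ∀ {v} → ¬ (v ∈ map (x ∷_) W × v ∈ concatMap (λ x → map (x ∷_) W) xs)
    disjoint (v∈x∷W , v∈rest) with w , _ , refl ← ∈-map⁻ (x ∷_) v∈x∷W
                               with y , y∈xs , v∈y∷W ← find (∈-concatMap⁻ (λ x → map (x ∷_) W) {xs = xs} v∈rest)
                               with _ , _ , x∷w≡y∷w′ ← ∈-map⁻ (y ∷_) v∈y∷W =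
      lookup x∉xs y∈xs (∷-injectiveˡ x∷w≡y∷w′)

∈-perms⁻ : ∀ {n π} → π ∈ perms n → length π ≡ n × IsPerm π
∈-perms⁻ {n} {π} π∈ = let π∈words , π-permᵇ = ∈-filter⁻ (T? ∘ isPermᵇ) π∈
                      in ∈-words⁻ n n π∈words , to (T-isPermᵇ π) π-permᵇ

∈-perms⁺ : ∀ {n π} → length π ≡ n → IsPerm π → π ∈ perms n
∈-perms⁺ {n} {π} |π| perm = ∈-filter⁺ (T? ∘ isPermᵇ)
  (∈-words⁺ n n |π| (subst (_ <_) |π| ∘ IsPerm⇒bounded perm)) (from (T-isPermᵇ π) perm)

Unique-perms : ∀ n → Unique (perms n)
Unique-perms n = filter⁺ (T? ∘ isPermᵇ) (Unique-words n n)

m+m≡n+n⇒m≡n : ∀ {m n} → m + m ≡ n + n → m ≡ n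
m+m≡n+n⇒m≡n {m} {n} e with <-cmp m n
... | tri< m<n _ _ = ⊥-elim (<-irrefl e (+-mono-< m<n m<n))
... | tri≈ _ m≡n _ = m≡n
... | tri> _ _ n<m = ⊥-elim (<-irrefl (sym e) (+-mono-< n<m n<m))

⊖-injectiveˡ : ∀ {σ σ′ τ τ′} → length σ ≡ length σ′ → length τ ≡ length τ′ → σ ⊖ τ ≡ σ′ ⊖ τ′ → σ ≡ σ′
⊖-injectiveˡ {[]}    {[]}     _   _   _ = refl
⊖-injectiveˡ {x ∷ σ} {y ∷ σ′} {τ} {τ′} |σ| |τ| e = cong₂ _∷_
  (+-cancelʳ-≡ (length τ) x y (trans (∷-injectiveˡ e) (cong (y +_) (sym |τ|))))
  (⊖-injectiveˡ (suc-injective |σ|) |τ| (∷-injectiveʳ e))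

length-⊖-inverse : ∀ π → length (π ⊖ inverse π) ≡ length π + length π
length-⊖-inverse π = trans (length-⊖ π (inverse π)) (cong (length π +_) (length-applyUpTo _ (length π)))

⊖-inverse-injective : ∀ {π π′} → π ⊖ inverse π ≡ π′ ⊖ inverse π′ → π ≡ π′
⊖-inverse-injective {π} {π′} e =
  ⊖-injectiveˡ |π| (trans (length-applyUpTo _ _) (trans |π| (sym (length-applyUpTo _ _)))) e
  where
  |π| : length π ≡ length π′
  |π| = m+m≡n+n⇒m≡n (trans (sym (length-⊖-inverse π)) (trans (cong length e) (length-⊖-inverse π′)))

avCount≤avInvCount : ∀ {β} → IsInvolution β → SkewIndecomposable β → ∀ n → avCount β n ≤ avInvCount β (n + n)
avCount≤avInvCount {β} β-involution indecomposable n = begin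
  avCount β n                       ≡⟨ length-map skewInverse avoiders ⟨
  length (map skewInverse avoiders) ≤⟨ Unique-⊆⇒length≤ image! image⊆ ⟩
  avInvCount β (n + n)              ∎
  where
  open ≤-Reasoning
  skewInverse : List ℕ → List ℕ
  skewInverse π = π ⊖ inverse π
  avoidsβ involutionAvoidsβ : List ℕ → Bool
  avoidsβ π = not (containsᵇ π β)
  involutionAvoidsβ π = isInvolutionᵇ π ∧ avoidsβ π
  avoiders = filterᵇ avoidsβ (perms n)
  image! : Unique (map skewInverse avoiders)
  image! = map⁺ ⊖-inverse-injective (filter⁺ (T? ∘ avoidsβ) (Unique-perms n))
  image⊆ : map skewInverse avoiders ⊆ filterᵇ involutionAvoidsβ (perms (n + n))
  image⊆ F∈ with π , π∈ , refl ← ∈-map⁻ skewInverse F∈ =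
    ∈-filter⁺ (T? ∘ involutionAvoidsβ) (∈-perms⁺ |F| (proj₁ F-involution))
      (from T-∧ (IsInvolution⇒isInvolutionᵇ F-involution , T-not F-avoids))
    where
    π-∈ = ∈-filter⁻ (T? ∘ avoidsβ) π∈
    |π|≡n = proj₁ (∈-perms⁻ {n} (proj₁ π-∈))
    π-perm = proj₂ (∈-perms⁻ {n} (proj₁ π-∈))
    F-involution = ⊖-involution π-perm (IsPerm-inverse π-perm) (inverse-Inverses π-perm)
    |F| : length (skewInverse π) ≡ n + n
    |F| = trans (length-⊖-inverse π) (cong₂ _+_ |π|≡n |π|≡n)
    F-avoids : ¬ T (containsᵇ (skewInverse π) β)
    F-avoids = ⊖-inverse-avoids β-involution indecomposable π-perm
                 (T-not⁻ (proj₂ π-∈) ∘ from (T-containsᵇ π β)) ∘ to (T-containsᵇ _ β)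

*-^-distrib : ∀ m n k → (m * n) ^ k ≡ m ^ k * n ^ k
*-^-distrib m n zero    = refl
*-^-distrib m n (suc k) = trans (cong (m * n *_) (*-^-distrib m n k)) (interchange m n (m ^ k) (n ^ k))

square-^ : ∀ p m → (p * p) ^ m ≡ p ^ (m + m)
square-^ p m = trans (*-^-distrib p p m) (sym (^-distribˡ-+-* p m m))

GrowthAbove⇒InfOftenAbove : ∀ {a b : ℕ → ℕ} {p q} → (∀ m → a m ≤ b (m + m)) →
                            GrowthAbove a p q → InfOftenAbove b p q
GrowthAbove⇒InfOftenAbove {a} {b} {p} {q} a≤b (u , v , s≤s _ , p²v<uq² , N₀ , growth) N =
  m + m , ≤-trans (m≤m+n N N₀) (m≤m+n m m) , *-cancelʳ-≤ _ _ (v ^ m) {{m^n≢0 v m}} bound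
  where
  open ≤-Reasoning
  m = N + N₀
  bound : p ^ (m + m) * v ^ m ≤ b (m + m) * q ^ (m + m) * v ^ m
  bound = begin
    p ^ (m + m) * v ^ m             ≡⟨ cong (_* v ^ m) (square-^ p m) ⟨
    (p * p) ^ m * v ^ m             ≡⟨ *-^-distrib (p * p) v m ⟨
    (p * p * v) ^ m                 ≤⟨ ^-monoˡ-≤ m (<⇒≤ p²v<uq²) ⟩
    (u * (q * q)) ^ m               ≡⟨ *-^-distrib u (q * q) m ⟩
    u ^ m * (q * q) ^ m             ≤⟨ *-monoˡ-≤ ((q * q) ^ m) (growth m (m≤n+m N₀ N)) ⟩
    a m * v ^ m * (q * q) ^ m       ≤⟨ *-monoˡ-≤ ((q * q) ^ m) (*-monoˡ-≤ (v ^ m) (a≤b m)) ⟩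
    b (m + m) * v ^ m * (q * q) ^ m ≡⟨ xy∙z≈xz∙y (b (m + m)) (v ^ m) ((q * q) ^ m) ⟩
    b (m + m) * (q * q) ^ m * v ^ m ≡⟨ cong (λ x → b (m + m) * x * v ^ m) (square-^ q m) ⟩
    b (m + m) * q ^ (m + m) * v ^ m ∎

proposition2p2 : (β : List ℕ) → IsInvolution β → SkewIndecomposable β →
    (p q : ℕ) → 1 ≤ q → GrowthAbove (avCount β) p q → InfOftenAbove (avInvCount β) p q
proposition2p2 β β-involution indecomposable p q _ =
  GrowthAbove⇒InfOftenAbove {avCount β} {avInvCount β} (avCount≤avInvCount β-involution indecomposable)
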